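{- For every permutation $\Pi$ and every finite strict double poset $d$, $$\langle\mathrm{DPC}^{\mathrm{regmono}}(\iota(\Pi)),d\rangle=\langle\mathrm{DPC}^{\mathrm{regmono}}(\iota(\Pi)),\mathrm{proj}(d)\rangle .$$
   Context: A finite strict double poset is a triple $(A,P_A,Q_A)$ with $A$ finite and $P_A,Q_A$ strict partial orders; morphisms are maps preserving both strict orders, forming a category. $\mathrm{RegMono}(d,D)$ is the set of regular monomorphisms (morphisms that are the equalizer of some parallel pair) from $d$ to $D$. On $V=\bigoplus_n\mathbb Q[\mathsf{DP}(n)]$ (free on isomorphism classes of finite strict double posets), $\mathrm{DPC}^{\mathrm{regmono}}(D)$ is the linear functional with $\langle\mathrm{DPC}^{\mathrm{regmono}}(D),d\rangle=\#\mathrm{RegMono}(d,D)$. For $\sigma\in\mathfrak S(n)$, $\iota(\sigma)=([n],\{(i,j):i<j\},\{(i,j):\sigma(i)<\sigma(j)\})$. $\mathrm{proj}:V\to V$ is linear with $\mathrm{proj}(d)=d$ if $d\cong\iota(\sigma)$ for some permutation $\sigma$, and $0$ otherwise. -}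

module Defs where

open import Level using (Level; 0ℓ)
open import Data.Nat using (ℕ)
open import Data.Fin using (Fin; _<_)
open import Data.Fin.Properties using (<-isStrictPartialOrder; <-irrefl; <-trans)
open import Data.Fin.Permutation using (Permutation′; _⟨$⟩ʳ_)
open import Data.Product using (Σ; _×_; _,_)
open import Data.Sum using (_⊎_)
open import Relation.Nullary using (¬_)
open import Relation.Binary using (Rel; IsStrictPartialOrder)
open import Relation.Binary.PropositionalEquality using (_≡_; refl; cong; subst; sym)

-- A finite strict double poset, with carrier Fin n (every finite set is
-- in bijection with some Fin n).
record DP : Set₁ where
  field
    n   : ℕ
    P   : Rel (Fin n) 0ℓ
    Q   : Rel (Fin n) 0ℓ
    isP : IsStrictPartialOrder _≡_ P
    isQ : IsStrictPartialOrder _≡_ Q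

open DP

record Hom (d D : DP) : Set where
  field
    fun   : Fin (n d) → Fin (n D)
    presP : ∀ {i j} → P d i j → P D (fun i) (fun j)
    presQ : ∀ {i j} → Q d i j → Q D (fun i) (fun j)

open Hom public

_≈H_ : ∀ {d D} → Hom d D → Hom d D → Set
f ≈H g = ∀ x → fun f x ≡ fun g x

_∘H_ : ∀ {a b c} → Hom b c → Hom a b → Hom a c
fun (g ∘H f) x = fun g (fun f x)
presP (g ∘H f) p = presP g (presP f p)
presQ (g ∘H f) p = presQ g (presQ f p)

idH : ∀ {a} → Hom a a
fun idH x = x
presP idH p = p
presQ idH p = p

IsEqualizer : ∀ {d D E} → Hom d D → Hom D E → Hom D E → Set₁
IsEqualizer {d} {D} {E} f g h =
  ((g ∘H f) ≈H (h ∘H f)) ×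
  (∀ (X : DP) (e : Hom X D) → (g ∘H e) ≈H (h ∘H e) →
     Σ (Hom X d) λ u → ((f ∘H u) ≈H e) ×
       (∀ (u′ : Hom X d) → (f ∘H u′) ≈H e → u′ ≈H u))

RegMono : ∀ {d D} → Hom d D → Set₁
RegMono {d} {D} f = Σ DP λ E → Σ (Hom D E) λ g → Σ (Hom D E) λ h → IsEqualizer f g h

-- "The set {a | Pr a}, taken up to _≈_, has exactly k elements":
-- an enumeration by Fin k, injective up to _≈_, hitting every element.
HasCard : ∀ {a ℓ r} {A : Set a} → (A → A → Set r) → (A → Set ℓ) → ℕ → Set _
HasCard {A = A} _≈_ Pr k =
  Σ (Fin k → A) λ e →
    (∀ i → Pr (e i)) ×
    (∀ i j → e i ≈ e j → i ≡ j) ×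
    (∀ a → Pr a → Σ (Fin k) λ i → a ≈ e i)

-- ⟨DPC^regmono(D), d⟩ = k   (as a relation: #RegMono(d,D) = k)
DPCregmono⟨_,_⟩≡_ : DP → DP → ℕ → Set₁
DPCregmono⟨ D , d ⟩≡ k = HasCard (_≈H_ {d} {D}) RegMono k

ι : ∀ {m} → Permutation′ m → DP
n (ι {m} σ) = m
P (ι σ) i j = i < j
Q (ι σ) i j = (σ ⟨$⟩ʳ i) < (σ ⟨$⟩ʳ j)
isP (ι σ) = <-isStrictPartialOrder
isQ (ι σ) = record
  { isEquivalence = Relation.Binary.PropositionalEquality.isEquivalence
  ; irrefl = λ { refl p → <-irrefl refl p }
  ; trans = <-trans
  ; <-resp-≈ = (λ { refl p → p }) , (λ { refl p → p })
  }

record Iso (d D : DP) : Set where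
  field
    to   : Hom d D
    from : Hom D d
    left  : (from ∘H to) ≈H idH
    right : (to ∘H from) ≈H idH

IsPermType : DP → Set
IsPermType d = Σ ℕ λ m → Σ (Permutation′ m) λ σ → Iso d (ι σ)

-- proj(d) ∈ V: either d itself or 0.
data V-elt : Set₁ where
  basis : DP → V-elt
  zeroV : V-elt

data IsProj (d : DP) : V-elt → Set where
  proj-perm : IsPermType d → IsProj d (basis d)
  proj-zero : ¬ IsPermType d → IsProj d zeroV

-- ⟨DPC^regmono(D), v⟩ = k for v ∈ {basis elements, 0} (linear: ⟨_,0⟩ = 0)
DPCregmonoV⟨_,_⟩≡_ : DP → V-elt → ℕ → Set₁
DPCregmonoV⟨ D , basis d ⟩≡ k = DPCregmono⟨ D , d ⟩≡ k
DPCregmonoV⟨ D , zeroV ⟩≡ k = Lift₁ (k ≡ 0)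
  where
  open import Level using () renaming (Lift to L)
  Lift₁ : Set → Set₁
  Lift₁ X = L (Level.suc 0ℓ) X

-- A regular monomorphism f : d → D of double posets is injective (test it against the
-- one-point double poset) and reflects both orders (factor the inclusion of its image,
-- ordered as in D, through f). For D = ι(Π) this exhibits P and Q of d as the orders
-- pulled back from Fin m along the injections f and Π ∘ f. Ranking the elements of d
-- in each order gives permutations φ, ψ with d ≅ ι(ψ ∘ φ⁻¹). So when d is not of
-- permutation type there is no regular monomorphism d → ι(Π) and both sides are 0;
-- otherwise proj(d) = d.
module Submission where

open import Defs
open import Data.Nat using (ℕ)
open import Data.Fin.Permutation using (Permutation′)
open import Function.Bundles using (_⇔_)

open import Level using (0ℓ; lift; lower)
import Data.Nat as ℕ
import Data.Nat.Properties as ℕ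
open import Data.Bool.Properties using (T-≡)
open import Data.Empty using (⊥; ⊥-elim)
open import Data.Fin using (Fin; zero; fromℕ<; punchOut; _≟_; _<_; _<?_)
open import Data.Fin.Properties
  using (any?; punchOut-injective; <⇒notInjective; toℕ-fromℕ<; <-cmp; <-irrefl; <-asym; <-trans)
open import Data.Fin.Permutation using (flip; _∘ₚ_; _⟨$⟩ʳ_; _⟨$⟩ˡ_; inverseˡ; inverseʳ)
open import Data.Fin.Subset using (Subset; _∈_; _⊂_; ⊤; ∣_∣)
open import Data.Fin.Subset.Properties using (∈⊤; ∣⊤∣≡n; p⊂q⇒∣p∣<∣q∣)
open import Data.Product using (Σ; ∃; _×_; _,_; proj₁; proj₂; map₂)
open import Data.Vec using (tabulate)
open import Data.Vec.Properties using (lookup∘tabulate; []=⇒lookup; lookup⇒[]=)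
open import Function.Base using (_∘_)
open import Function.Bundles using (mk⇔; mk⤖; Equivalence; Injection)
open import Function.Consequences.Propositional using (strictlySurjective⇒surjective)
open import Function.Construct.Composition using (_⇔-∘_)
open import Function.Construct.Identity using (⇔-id)
open import Function.Definitions using (Injective; StrictlySurjective)
open import Function.Properties.Bijection using (⤖⇒↔)
open import Function.Properties.Inverse using (↔⇒↣)
open import Relation.Binary using (Rel; IsStrictPartialOrder; tri<; tri≈; tri>)
open import Relation.Binary.PropositionalEquality
  using (_≡_; _≢_; refl; sym; trans; cong; subst; subst₂; isEquivalence)
open import Relation.Nullary using (¬_)
open import Relation.Nullary.Decidable using (isYes; decidable-stable; toWitness; fromWitness)

open DP
open Equivalence using (to; from)

point : DP
n point = 1
P point _ _ = ⊥
Q point _ _ = ⊥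
isP point = emptyIsStrictPartialOrder
  where
  emptyIsStrictPartialOrder : IsStrictPartialOrder _≡_ (λ (_ _ : Fin 1) → ⊥)
  emptyIsStrictPartialOrder = record
    { isEquivalence = isEquivalence
    ; irrefl = λ _ ()
    ; trans = λ ()
    ; <-resp-≈ = (λ _ ()) , (λ _ ())
    }
isQ point = isP point

element : (D : DP) → Fin (n D) → Hom point D
fun (element D x) _ = x
presP (element D x) ()
presQ (element D x) ()

pullbackIsStrictPartialOrder : ∀ {k m} {R : Rel (Fin m) 0ℓ} (κ : Fin k → Fin m) →
  IsStrictPartialOrder _≡_ R → IsStrictPartialOrder _≡_ (λ i j → R (κ i) (κ j))
pullbackIsStrictPartialOrder κ isR = record
  { isEquivalence = isEquivalence
  ; irrefl = λ { refl → IsStrictPartialOrder.irrefl isR refl }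
  ; trans = IsStrictPartialOrder.trans isR
  ; <-resp-≈ = (λ { refl r → r }) , (λ { refl r → r })
  }

induced : (D : DP) {k : ℕ} → (Fin k → Fin (n D)) → DP
n (induced D {k} κ) = k
P (induced D κ) i j = P D (κ i) (κ j)
Q (induced D κ) i j = Q D (κ i) (κ j)
isP (induced D κ) = pullbackIsStrictPartialOrder κ (isP D)
isQ (induced D κ) = pullbackIsStrictPartialOrder κ (isQ D)

inclusion : (D : DP) {k : ℕ} (κ : Fin k → Fin (n D)) → Hom (induced D κ) D
fun (inclusion D κ) = κ
presP (inclusion D κ) p = p
presQ (inclusion D κ) q = q

module _ {d D : DP} {f : Hom d D} (regMono : RegMono f) where

  private
    E = proj₁ regMono
    g h : Hom D E
    g = proj₁ (proj₂ regMono)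
    h = proj₁ (proj₂ (proj₂ regMono))

    equalizes : (g ∘H f) ≈H (h ∘H f)
    equalizes = proj₁ (proj₂ (proj₂ (proj₂ regMono)))

    factor : ∀ X (e : Hom X D) → (g ∘H e) ≈H (h ∘H e) →
             Σ (Hom X d) λ u → ((f ∘H u) ≈H e) × (∀ u′ → (f ∘H u′) ≈H e → u′ ≈H u)
    factor = proj₂ (proj₂ (proj₂ (proj₂ regMono)))

  regMono-monic : ∀ {X} (u v : Hom X d) → (f ∘H u) ≈H (f ∘H v) → u ≈H v
  regMono-monic {X} u v fu≈fv x = trans (unique u (λ _ → refl) x) (sym (unique v (sym ∘ fu≈fv) x))
    where
    unique : ∀ w → (f ∘H w) ≈H (f ∘H u) → w ≈H proj₁ (factor X (f ∘H u) (equalizes ∘ fun u))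
    unique = proj₂ (proj₂ (factor X (f ∘H u) (equalizes ∘ fun u)))

  regMono-injective : Injective _≡_ _≡_ (fun f)
  regMono-injective {x} {y} fx≡fy = regMono-monic (element d x) (element d y) (λ _ → fx≡fy) zero

  private
    corestriction : Σ (Hom (induced D (fun f)) d) λ u → (f ∘H u) ≈H inclusion D (fun f)
    corestriction = map₂ proj₁ (factor _ (inclusion D (fun f)) equalizes)

    corestriction≗id : ∀ i → fun (proj₁ corestriction) i ≡ i
    corestriction≗id i = regMono-injective (proj₂ corestriction i)

  regMono-reflectsP : ∀ {i j} → P D (fun f i) (fun f j) → P d i j
  regMono-reflectsP p = subst₂ (P d) (corestriction≗id _) (corestriction≗id _) (presP (proj₁ corestriction) p)

  regMono-reflectsQ : ∀ {i j} → Q D (fun f i) (fun f j) → Q d i j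
  regMono-reflectsQ q = subst₂ (Q d) (corestriction≗id _) (corestriction≗id _) (presQ (proj₁ corestriction) q)

injective⇒strictlySurjective : ∀ {k} {f : Fin k → Fin k} → Injective _≡_ _≡_ f → StrictlySurjective _≡_ f
injective⇒strictlySurjective {ℕ.suc k} {f} f-injective a = decidable-stable (any? (λ i → f i ≟ a)) a∈image
  where
  a∈image : ¬ ¬ ∃ λ i → f i ≡ a
  a∈image a∉image = <⇒notInjective (ℕ.n<1+n k) avoid-injective
    where
    a≢f : ∀ i → a ≢ f i
    a≢f i a≡fi = a∉image (i , sym a≡fi)

    avoid : Fin (ℕ.suc k) → Fin k
    avoid i = punchOut (a≢f i)

    avoid-injective : Injective _≡_ _≡_ avoid
    avoid-injective = f-injective ∘ punchOut-injective (a≢f _) (a≢f _)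

injective⇒permutation : ∀ {k} (f : Fin k → Fin k) → Injective _≡_ _≡_ f → Permutation′ k
injective⇒permutation f f-injective =
  ⤖⇒↔ (mk⤖ {to = f} (f-injective , strictlySurjective⇒surjective (injective⇒strictlySurjective f-injective)))

module Ranking {k M : ℕ} (κ : Fin k → Fin M) (κ-injective : Injective _≡_ _≡_ κ) where

  below : Fin k → Subset k
  below i = tabulate λ j → isYes (κ j <? κ i)

  ∈-below⁺ : ∀ {i j} → κ j < κ i → j ∈ below i
  ∈-below⁺ {i} {j} κj<κi = lookup⇒[]= j (below i) (trans (lookup∘tabulate _ j) (to T-≡ (fromWitness κj<κi)))

  ∈-below⁻ : ∀ {i j} → j ∈ below i → κ j < κ i
  ∈-below⁻ {i} {j} j∈below =
    toWitness (from T-≡ (trans (sym (lookup∘tabulate (λ j → isYes (κ j <? κ i)) j)) ([]=⇒lookup j∈below)))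

  below-⊂ : ∀ {i j} → κ i < κ j → below i ⊂ below j
  below-⊂ {i} κi<κj = (λ l∈below → ∈-below⁺ (<-trans (∈-below⁻ l∈below) κi<κj)) ,
                      i , ∈-below⁺ κi<κj , λ i∈below → <-irrefl refl (∈-below⁻ i∈below)

  below-⊂-⊤ : ∀ i → below i ⊂ ⊤
  below-⊂-⊤ i = (λ _ → ∈⊤) , i , ∈⊤ , λ i∈below → <-irrefl refl (∈-below⁻ i∈below)

  rank : Fin k → Fin k
  rank i = fromℕ< (subst (∣ below i ∣ ℕ.<_) (∣⊤∣≡n k) (p⊂q⇒∣p∣<∣q∣ (below-⊂-⊤ i)))

  rank-mono : ∀ {i j} → κ i < κ j → rank i < rank j
  rank-mono κi<κj = subst₂ ℕ._<_ (sym (toℕ-fromℕ< _)) (sym (toℕ-fromℕ< _)) (p⊂q⇒∣p∣<∣q∣ (below-⊂ κi<κj))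

  rank-reflects : ∀ {i j} → rank i < rank j → κ i < κ j
  rank-reflects {i} {j} ri<rj with <-cmp (κ i) (κ j)
  ... | tri< κi<κj _ _ = κi<κj
  ... | tri≈ _ κi≡κj _ = ⊥-elim (<-irrefl (cong rank (κ-injective κi≡κj)) ri<rj)
  ... | tri> _ _ κj<κi = ⊥-elim (<-asym ri<rj (rank-mono κj<κi))

  rank-injective : Injective _≡_ _≡_ rank
  rank-injective {i} {j} ri≡rj with <-cmp (κ i) (κ j)
  ... | tri< κi<κj _ _ = ⊥-elim (<-irrefl ri≡rj (rank-mono κi<κj))
  ... | tri≈ _ κi≡κj _ = κ-injective κi≡κj
  ... | tri> _ _ κj<κi = ⊥-elim (<-irrefl (sym ri≡rj) (rank-mono κj<κi))

  rankPermutation : Permutation′ k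
  rankPermutation = injective⇒permutation rank rank-injective

  <⇔rank< : ∀ {i j} → κ i < κ j ⇔ rankPermutation ⟨$⟩ʳ i < rankPermutation ⟨$⟩ʳ j
  <⇔rank< = mk⇔ rank-mono rank-reflects

_IsInducedBy_ : ∀ {k M} → Rel (Fin k) 0ℓ → (Fin k → Fin M) → Set
R IsInducedBy κ = ∀ {i j} → R i j ⇔ κ i < κ j

isPermType-fromPermutations : ∀ d (φ ψ : Permutation′ (n d)) →
  P d IsInducedBy (φ ⟨$⟩ʳ_) → Q d IsInducedBy (ψ ⟨$⟩ʳ_) → IsPermType d
isPermType-fromPermutations d φ ψ P⇔ Q⇔ = n d , σ , iso
  where
  -- _∘ₚ_ composes diagrammatically, so σ = ψ ∘ φ⁻¹.
  σ : Permutation′ (n d)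
  σ = flip φ ∘ₚ ψ

  σ∘φ≗ψ : ∀ i → σ ⟨$⟩ʳ (φ ⟨$⟩ʳ i) ≡ ψ ⟨$⟩ʳ i
  σ∘φ≗ψ _ = cong (ψ ⟨$⟩ʳ_) (inverseˡ φ)

  iso : Iso d (ι σ)
  fun (Iso.to iso) = φ ⟨$⟩ʳ_
  presP (Iso.to iso) = to P⇔
  presQ (Iso.to iso) q = subst₂ _<_ (sym (σ∘φ≗ψ _)) (sym (σ∘φ≗ψ _)) (to Q⇔ q)
  fun (Iso.from iso) = φ ⟨$⟩ˡ_
  presP (Iso.from iso) a<b = from P⇔ (subst₂ _<_ (sym (inverseʳ φ)) (sym (inverseʳ φ)) a<b)
  presQ (Iso.from iso) = from Q⇔
  Iso.left iso _ = inverseˡ φ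
  Iso.right iso _ = inverseʳ φ

isPermType-fromEmbeddings : ∀ d {M} (κ₁ κ₂ : Fin (n d) → Fin M) →
  Injective _≡_ _≡_ κ₁ → Injective _≡_ _≡_ κ₂ →
  P d IsInducedBy κ₁ → Q d IsInducedBy κ₂ → IsPermType d
isPermType-fromEmbeddings d κ₁ κ₂ κ₁-injective κ₂-injective P⇔ Q⇔ =
  isPermType-fromPermutations d R₁.rankPermutation R₂.rankPermutation (R₁.<⇔rank< ⇔-∘ P⇔) (R₂.<⇔rank< ⇔-∘ Q⇔)
  where
  module R₁ = Ranking κ₁ κ₁-injective
  module R₂ = Ranking κ₂ κ₂-injective

regMono⇒isPermType : ∀ {m} (Π : Permutation′ m) {d} (f : Hom d (ι Π)) → RegMono f → IsPermType d
regMono⇒isPermType Π {d} f regMono =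
  isPermType-fromEmbeddings d (fun f) ((Π ⟨$⟩ʳ_) ∘ fun f) f-injective (f-injective ∘ Π-injective)
    (mk⇔ (presP f) (regMono-reflectsP {f = f} regMono))
    (mk⇔ (presQ f) (regMono-reflectsQ {f = f} regMono))
  where
  f-injective : Injective _≡_ _≡_ (fun f)
  f-injective = regMono-injective {f = f} regMono

  Π-injective : Injective _≡_ _≡_ (Π ⟨$⟩ʳ_)
  Π-injective = Injection.injective (↔⇒↣ Π)

hasCard⇔≡0 : ∀ {a ℓ r} {A : Set a} {_≈_ : A → A → Set r} {Pr : A → Set ℓ} {k} →
  (∀ x → ¬ Pr x) → HasCard _≈_ Pr k ⇔ k ≡ 0
hasCard⇔≡0 {k = ℕ.zero} none = mk⇔ (λ _ → refl) (λ _ → (λ ()) , (λ ()) , (λ ()) , λ x px → ⊥-elim (none x px))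
hasCard⇔≡0 {k = ℕ.suc _} none = mk⇔ (λ (e , e-valid , _) → ⊥-elim (none (e zero) (e-valid zero))) (λ ())

lemma3p6 : ∀ {m} (Π : Permutation′ m) (d : DP) (p : V-elt) → IsProj d p →
    ∀ (k : ℕ) → (DPCregmono⟨ ι Π , d ⟩≡ k) ⇔ (DPCregmonoV⟨ ι Π , p ⟩≡ k)
lemma3p6 Π d .(basis d) (proj-perm _) k = ⇔-id _
lemma3p6 Π d .zeroV (proj-zero ¬permType) k =
  mk⇔ lift lower ⇔-∘ hasCard⇔≡0 {_≈_ = _≈H_} (λ f → ¬permType ∘ regMono⇒isPermType Π f)
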